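{- Let $n\ge1$, let $L,R\subseteq\{1,\dots,n\}$ with $|L|=|R|$, and suppose $i\in L\cap R$. Then in the lattice $NC_B(n)$, \[ \eta(L,R) \leq \eta(L\setminus\{i\}, R\setminus\{i\}).\]
   Context: A $B_n$-partition is a set partition $\pi$ of $[\pm n]=\{\pm1,\dots,\pm n\}$ such that $-B$ is a block whenever $B$ is, and at most one block $B$ satisfies $B=-B$ (the zero block). Place $1,2,\dots,n,-1,-2,\dots,-n$ clockwise around a circle; $\pi$ is noncrossing if the convex hulls of its blocks are pairwise disjoint. $NC_B(n)$ is the set of noncrossing $B_n$-partitions, ordered by reverse refinement ($\pi\le\pi'$ iff every block of $\pi$ is contained in a block of $\pi'$). The map $\eta$: given $L,R\subseteq[n]$ with $|L|=|R|$, write the cyclic sequence $1,2,\dots,n,-1,\dots,-n$; for each $i\in L$ put a left parenthesis immediately before $i$ and before $-i$, and for each $j\in R$ put a right parenthesis immediately after $j$ and after $-j$. Match parentheses cyclically (repeatedly pair a "(" with the first ")" following it clockwise with no parenthesis in between, remove the pair, and continue). Each matched pair determines a block consisting of the elements enclosed (clockwise from "(" to ")") by that pair but not by any pair nested inside it; the elements not enclosed by any pair form one additional block (if nonempty). $\eta(L,R)$ is the resulting partition, which lies in $NC_B(n)$. Example: $\eta(\{2,3,4\},\{1,4,5\})=\{\{1,-2\},\{ -1,2\},\{3,5\},\{ -3,-5\},\{4\},\{ -4\}\}$ for $n=5$; $\eta(\emptyset,\emptyset)$ is the one-block partition. -}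

module Defs where

open import Data.Bool using (Bool; true; false; if_then_else_)
open import Data.Nat using (ℕ; zero; suc)
open import Data.Integer using (ℤ; +_; -[1+_])
open import Data.Fin using (Fin; toℕ)
open import Data.Fin.Subset using (Subset)
open import Data.Vec using (lookup)
open import Data.List using (List; []; _∷_; _++_; map; concatMap; reverse; length)
open import Data.List.Relation.Unary.All using (All)
open import Data.List.Relation.Unary.Any using (Any)
open import Data.List.Relation.Binary.Subset.Propositional using (_⊆_)
open import Data.Maybe using (Maybe; just; nothing)
open import Data.Product using (_×_; _,_)
open import Data.Fin.Base using () renaming (toℕ to fin→ℕ)
open import Data.List.Base using (allFin)

-- Elements of [±n]: the integer +a stands for a, -[1+ a-1 ] stands for -a.
-- A B_n-partition (or any set partition) is represented by its list of blocks.
Block : Set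
Block = List ℤ

Partition : Set
Partition = List Block

_≤NC_ : Partition → Partition → Set
π ≤NC π' = All (λ B → Any (λ B' → B ⊆ B') π') π

data Tok : Set where
  lp : Tok
  rp : Tok
  el : ℤ → Tok

-- The tokens around one element x whose absolute value is j+1 (j : Fin n).
tokensAt : ∀ {n} → Subset n → Subset n → Fin n → ℤ → List Tok
tokensAt L R j x =
  (if lookup L j then lp ∷ [] else []) ++ el x ∷ (if lookup R j then rp ∷ [] else [])

-- The cyclic sequence 1,2,…,n,-1,…,-n with parentheses inserted
-- (read as a cycle: the last token is followed by the first).
tokens : ∀ {n} → Subset n → Subset n → List Tok
tokens {n} L R =
  concatMap (λ j → tokensAt L R j (+ suc (toℕ j))) (allFin n) ++
  concatMap (λ j → tokensAt L R j (-[1+ toℕ j ])) (allFin n)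

elems : List Tok → List ℤ
elems [] = []
elems (el x ∷ ts) = x ∷ elems ts
elems (_ ∷ ts) = elems ts

elemsThenRp : List Tok → Maybe (List ℤ × List Tok)
elemsThenRp [] = nothing
elemsThenRp (lp ∷ _) = nothing
elemsThenRp (rp ∷ ts) = just ([] , ts)
elemsThenRp (el x ∷ ts) with elemsThenRp ts
... | just (b , rest) = just (x ∷ b , rest)
... | nothing = nothing

findPair : List Tok → Maybe (List Tok × List ℤ × List Tok)
findPair [] = nothing
findPair (lp ∷ ts) with elemsThenRp ts
... | just (b , rest) = just ([] , b , rest)
... | nothing with findPair ts
...   | just (bef , b , aft) = just (lp ∷ bef , b , aft)
...   | nothing = nothing
findPair (t ∷ ts) with findPair ts
... | just (bef , b , aft) = just (t ∷ bef , b , aft)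
... | nothing = nothing

leadElems : List Tok → List ℤ × List Tok
leadElems (el x ∷ ts) with leadElems ts
... | (a , rest) = (x ∷ a , rest)
leadElems ts = ([] , ts)

-- The wrap-around pair: the sequence has the form A ) M ( C with A, C
-- elements only; the last "(" is matched cyclically with the first ")".
wrapPair : List Tok → Maybe (List ℤ × List Tok)
wrapPair ts with leadElems ts
... | (a , rp ∷ ys) with leadElems (reverse ys)
...   | (rc , lp ∷ zs) = just (reverse rc ++ a , reverse zs)
...   | _ = nothing
wrapPair ts | _ = nothing

-- The elements not enclosed by any pair form one more block (if nonempty).
leftover : List Tok → Partition
leftover ts with elems ts
... | [] = []
... | es = es ∷ []

-- Repeatedly match and remove a pair together with the elements it
-- encloses (those not enclosed by a nested pair, which were removed before).
-- The fuel (length of the token list) suffices: each step removes two tokens.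
matchLoop : ℕ → List Tok → Partition
matchLoop zero ts = leftover ts
matchLoop (suc k) ts with findPair ts
... | just (bef , b , aft) = b ∷ matchLoop k (bef ++ aft)
... | nothing with wrapPair ts
...   | just (b , mid) = b ∷ matchLoop k mid
...   | nothing = leftover ts

η : ∀ {n} → Subset n → Subset n → Partition
η L R = matchLoop (length (tokens L R)) (tokens L R)

-- Since i ∈ L ∩ R, the cyclic sequence for (L, R) contains the pairs "( i )" and "( −i )", and
-- the sequence for (L ∖ {i}, R ∖ {i}) is the same one with these four parentheses deleted.
-- A pair enclosing a single element is matched directly and contributes just that singleton
-- block, so deleting it only deletes the singleton.  Making the element bare again enlarges
-- blocks, because element tokens never influence which parentheses get matched, and the
-- element itself then lies in some block.  Doing this for i and then for −i gives the claim.

module Submission where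

open import Defs
open import Data.Bool using (true; false)
open import Data.Empty using (⊥; ⊥-elim)
open import Data.Fin using (Fin; zero; suc; toℕ)
open import Data.Fin.Properties using (suc-injective)
open import Data.Fin.Subset using (Subset; _∈_; ∣_∣; _─_; ⁅_⁆)
open import Data.Fin.Subset.Properties using (p─⊥≡p)
open import Data.Integer using (ℤ; +_; -[1+_])
open import Data.List using (List; []; _∷_; _∷ʳ_; _++_; map; concat; concatMap; tabulate; allFin; reverse; length)
open import Data.List.Properties
  using (++-assoc; ++-identityʳ; unfold-reverse; reverse-++; reverse-map; reverse-involutive; map-tabulate; tabulate-cong)
open import Data.List.Membership.Propositional using () renaming (_∈_ to _∈ₗ_)
open import Data.List.Membership.Propositional.Properties using (∈-++⁻; ∈-++⁺ʳ)
open import Data.List.Relation.Binary.Subset.Propositional using (_⊆_)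
open import Data.List.Relation.Binary.Subset.Propositional.Properties
  using (⊆-refl; ⊆-trans; ⊆-reflexive-↭; ∷⁺ʳ; xs⊆x∷xs; ++⁺)
open import Data.List.Relation.Binary.Permutation.Propositional using (module PermutationReasoning)
open import Data.List.Relation.Binary.Permutation.Propositional.Properties using (shifts; ++-comm)
open import Data.List.Relation.Unary.All using ([]; _∷_) renaming (map to All-map)
open import Data.List.Relation.Unary.Any using (Any; here; there) renaming (map to Any-map)
import Data.List.Relation.Unary.All.Properties as All
import Data.List.Relation.Unary.Any.Properties as Any
open import Data.Maybe using (just; nothing)
open import Data.Maybe.Relation.Binary.Pointwise using (Pointwise; just; nothing)
open import Data.Nat using (ℕ; zero; suc; _+_; _≤_; z≤n; s≤s)
open import Data.Nat.Properties using (≤-trans; n≤1+n; +-suc; +-comm; ≤-pred)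
open import Data.Product using (_×_; _,_; ∃-syntax)
open import Data.Sum using (inj₁; inj₂)
open import Data.Unit using (⊤; tt)
open import Data.Vec using (lookup; _∷_)
open import Data.Vec.Properties using ([]=⇒lookup)
open import Function using (_∘_; id)
open import Relation.Binary.PropositionalEquality

≤NC-there : ∀ {π π′ : Partition} B → π ≤NC π′ → π ≤NC (B ∷ π′)
≤NC-there B = All-map there

≤NC-refl : ∀ π → π ≤NC π
≤NC-refl []      = []
≤NC-refl (B ∷ π) = here ⊆-refl ∷ ≤NC-there B (≤NC-refl π)

≤NC-trans : ∀ {π π′ π″ : Partition} → π ≤NC π′ → π′ ≤NC π″ → π ≤NC π″
≤NC-trans p q = All-map (λ B⊆ → inBlock-trans B⊆ q) p
  where
  inBlock-trans : ∀ {B : List ℤ} {π π′ : Partition} →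
                  Any (B ⊆_) π → π ≤NC π′ → Any (B ⊆_) π′
  inBlock-trans (here s)  (a ∷ _)  = Any-map (⊆-trans s) a
  inBlock-trans (there p) (_ ∷ as) = inBlock-trans p as

≤NC-∷ʳ-covered : ∀ {π π′ : Partition} {x} →
                 π ≤NC π′ → Any (x ∈ₗ_) π′ → (π ∷ʳ (x ∷ [])) ≤NC π′
≤NC-∷ʳ-covered p c = All.∷ʳ⁺ p (Any-map (λ { x∈B (here refl) → x∈B }) c)

⊆-reverse : ∀ {as bs : List ℤ} → as ⊆ bs → reverse as ⊆ reverse bs
⊆-reverse s p = Any.reverse⁺ (s (Any.reverse⁻ p))

reverse-split : ∀ {A : Set} {ys us zs : List A} {t} → reverse ys ≡ us ++ t ∷ zs →
                ys ≡ reverse zs ++ t ∷ reverse us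
reverse-split {ys = ys} {us} {zs} {t} eq = begin
  ys                              ≡⟨ reverse-involutive ys ⟨
  reverse (reverse ys)            ≡⟨ cong reverse eq ⟩
  reverse (us ++ t ∷ zs)          ≡⟨ reverse-++ us (t ∷ zs) ⟩
  reverse (t ∷ zs) ++ reverse us  ≡⟨ cong (_++ reverse us) (unfold-reverse t zs) ⟩
  (reverse zs ++ t ∷ []) ++ reverse us ≡⟨ ++-assoc (reverse zs) (t ∷ []) (reverse us) ⟩
  reverse zs ++ t ∷ reverse us    ∎
  where open ≡-Reasoning

++-regroup : ∀ {A : Set} (a u c a′ v c′ : List A) →
             (a ++ u ++ c) ++ (a′ ++ v ++ c′) ≡ a ++ u ++ (c ++ a′) ++ v ++ c′
++-regroup a u c a′ v c′ = begin
  (a ++ u ++ c) ++ (a′ ++ v ++ c′)  ≡⟨ ++-assoc a (u ++ c) _ ⟩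
  a ++ (u ++ c) ++ (a′ ++ v ++ c′)  ≡⟨ cong (a ++_) (++-assoc u c _) ⟩
  a ++ u ++ c ++ a′ ++ v ++ c′      ≡⟨ cong (λ w → a ++ u ++ w) (++-assoc c a′ _) ⟨
  a ++ u ++ (c ++ a′) ++ v ++ c′    ∎
  where open ≡-Reasoning

concat-tabulate-split : ∀ {A : Set} {n} (F G : Fin n → List A) i → (∀ j → j ≢ i → F j ≡ G j) →
  ∃[ P ] ∃[ S ] concat (tabulate F) ≡ P ++ F i ++ S × concat (tabulate G) ≡ P ++ G i ++ S
concat-tabulate-split F G zero agree =
  [] , concat (tabulate (F ∘ suc)) , refl ,
  cong (λ Fs → G zero ++ concat Fs) (tabulate-cong (λ j → sym (agree (suc j) λ ())))
concat-tabulate-split F G (suc i) agree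
  with concat-tabulate-split (F ∘ suc) (G ∘ suc) i (λ j j≢i → agree (suc j) (j≢i ∘ suc-injective))
... | P , S , eqF , eqG =
  F zero ++ P , S ,
  trans (cong (F zero ++_) eqF) (sym (++-assoc (F zero) P _)) ,
  trans (cong₂ _++_ (sym (agree zero λ ())) eqG) (sym (++-assoc (F zero) P _))

concatMap-allFin : ∀ {A : Set} {n} (F : Fin n → List A) → concatMap F (allFin n) ≡ concat (tabulate F)
concatMap-allFin F = cong concat (map-tabulate id F)

opens : List Tok → ℕ
opens []        = 0
opens (lp ∷ ts) = suc (opens ts)
opens (_  ∷ ts) = opens ts

opens-++ : ∀ xs ys → opens (xs ++ ys) ≡ opens xs + opens ys
opens-++ []          ys = refl
opens-++ (lp ∷ xs)   ys = cong suc (opens-++ xs ys)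
opens-++ (rp ∷ xs)   ys = opens-++ xs ys
opens-++ (el _ ∷ xs) ys = opens-++ xs ys

opens-map-el : ∀ a → opens (map el a) ≡ 0
opens-map-el []      = refl
opens-map-el (_ ∷ a) = opens-map-el a

opens≤length : ∀ ts → opens ts ≤ length ts
opens≤length []          = z≤n
opens≤length (lp ∷ ts)   = s≤s (opens≤length ts)
opens≤length (rp ∷ ts)   = ≤-trans (opens≤length ts) (n≤1+n _)
opens≤length (el _ ∷ ts) = ≤-trans (opens≤length ts) (n≤1+n _)

elems-++ : ∀ xs ys → elems (xs ++ ys) ≡ elems xs ++ elems ys
elems-++ []          ys = refl
elems-++ (lp ∷ xs)   ys = elems-++ xs ys
elems-++ (rp ∷ xs)   ys = elems-++ xs ys
elems-++ (el x ∷ xs) ys = cong (x ∷_) (elems-++ xs ys)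

elems-map-el : ∀ a → elems (map el a) ≡ a
elems-map-el []      = refl
elems-map-el (x ∷ a) = cong (x ∷_) (elems-map-el a)

elemsThenRp-sound : ∀ ts {b r} → elemsThenRp ts ≡ just (b , r) → ts ≡ map el b ++ rp ∷ r
elemsThenRp-sound (rp ∷ ts) refl = refl
elemsThenRp-sound (el x ∷ ts) eq with elemsThenRp ts in eq′
elemsThenRp-sound (el x ∷ ts) refl | just _ = cong (el x ∷_) (elemsThenRp-sound ts eq′)

findPair-sound : ∀ ts {bef b aft} → findPair ts ≡ just (bef , b , aft) →
                 ts ≡ bef ++ lp ∷ map el b ++ rp ∷ aft
findPair-sound (lp ∷ ts) eq with elemsThenRp ts in eq′
findPair-sound (lp ∷ ts) refl | just _ = cong (lp ∷_) (elemsThenRp-sound ts eq′)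
... | nothing with findPair ts in eq″
findPair-sound (lp ∷ ts) refl | nothing | just _ = cong (lp ∷_) (findPair-sound ts eq″)
findPair-sound (rp ∷ ts) eq with findPair ts in eq′
findPair-sound (rp ∷ ts) refl | just _ = cong (rp ∷_) (findPair-sound ts eq′)
findPair-sound (el x ∷ ts) eq with findPair ts in eq′
findPair-sound (el x ∷ ts) refl | just _ = cong (el x ∷_) (findPair-sound ts eq′)

leadElems-sound : ∀ ts {a r} → leadElems ts ≡ (a , r) → ts ≡ map el a ++ r
leadElems-sound []        refl = refl
leadElems-sound (lp ∷ ts) refl = refl
leadElems-sound (rp ∷ ts) refl = refl
leadElems-sound (el x ∷ ts) eq with leadElems ts in eq′
leadElems-sound (el x ∷ ts) refl | _ = cong (el x ∷_) (leadElems-sound ts eq′)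

wrapPair-sound : ∀ ts {b mid} → wrapPair ts ≡ just (b , mid) →
                 ∃[ a ] ∃[ c ] ts ≡ map el a ++ rp ∷ mid ++ lp ∷ map el c × b ≡ c ++ a
wrapPair-sound ts eq with leadElems ts in e₁
... | (a , rp ∷ ys) with leadElems (reverse ys) in e₂
...   | (rc , lp ∷ zs) with eq
...     | refl = a , reverse rc , trans (leadElems-sound ts e₁) (cong (λ ys → map el a ++ rp ∷ ys) ys≡) , refl
  where
  ys≡ : ys ≡ reverse zs ++ lp ∷ map el (reverse rc)
  ys≡ = trans (reverse-split (leadElems-sound (reverse ys) e₂))
              (cong (λ u → reverse zs ++ lp ∷ u) (sym (reverse-map el rc)))

opens-pair : ∀ bef b aft → opens (bef ++ lp ∷ map el b ++ rp ∷ aft) ≡ suc (opens (bef ++ aft))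
opens-pair bef b aft = begin
  opens (bef ++ lp ∷ map el b ++ rp ∷ aft)         ≡⟨ opens-++ bef _ ⟩
  opens bef + suc (opens (map el b ++ rp ∷ aft))   ≡⟨ cong (λ n → opens bef + suc n) (opens-++ (map el b) _) ⟩
  opens bef + suc (opens (map el b) + opens aft)
    ≡⟨ cong (λ n → opens bef + suc (n + opens aft)) (opens-map-el b) ⟩
  opens bef + suc (opens aft)                      ≡⟨ +-suc (opens bef) (opens aft) ⟩
  suc (opens bef + opens aft)                      ≡⟨ cong suc (opens-++ bef aft) ⟨
  suc (opens (bef ++ aft))                         ∎
  where open ≡-Reasoning

findPair-opens : ∀ ts {bef b aft} → findPair ts ≡ just (bef , b , aft) → opens ts ≡ suc (opens (bef ++ aft))
findPair-opens ts {bef} {b} {aft} eq rewrite findPair-sound ts eq = opens-pair bef b aft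

wrapPair-opens : ∀ ts {b mid} → wrapPair ts ≡ just (b , mid) → opens ts ≡ suc (opens mid)
wrapPair-opens ts {mid = mid} eq with wrapPair-sound ts eq
... | a , c , refl , _
  rewrite opens-++ (map el a) (rp ∷ mid ++ lp ∷ map el c) | opens-map-el a
        | opens-++ mid (lp ∷ map el c) | opens-map-el c = +-comm (opens mid) 1

findPair-elems : ∀ ts {bef b aft} → findPair ts ≡ just (bef , b , aft) → elems ts ⊆ b ++ elems (bef ++ aft)
findPair-elems ts {bef} {b} {aft} eq
  rewrite findPair-sound ts eq | elems-++ bef (lp ∷ map el b ++ rp ∷ aft)
        | elems-++ (map el b) (rp ∷ aft) | elems-map-el b | elems-++ bef aft =
  ⊆-reflexive-↭ (shifts (elems bef) b)

wrapPair-elems : ∀ ts {b mid} → wrapPair ts ≡ just (b , mid) → elems ts ⊆ b ++ elems mid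
wrapPair-elems ts {mid = mid} eq with wrapPair-sound ts eq
... | a , c , refl , refl
  rewrite elems-++ (map el a) (rp ∷ mid ++ lp ∷ map el c) | elems-map-el a
        | elems-++ mid (lp ∷ map el c) | elems-map-el c = ⊆-reflexive-↭ (begin
  a ++ elems mid ++ c      ↭⟨ ++-comm a (elems mid ++ c) ⟩
  (elems mid ++ c) ++ a    ≡⟨ ++-assoc (elems mid) c a ⟩
  elems mid ++ c ++ a      ↭⟨ ++-comm (elems mid) (c ++ a) ⟩
  (c ++ a) ++ elems mid    ∎)
  where open PermutationReasoning

matchLoop-exhausted : ∀ k ts → opens ts ≤ 0 → matchLoop (suc k) ts ≡ leftover ts
matchLoop-exhausted k ts h with findPair ts in eq
... | just _ with () ← subst (_≤ 0) (findPair-opens ts eq) h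
... | nothing with wrapPair ts in eq′
...   | just _ with () ← subst (_≤ 0) (wrapPair-opens ts eq′) h
...   | nothing = refl

≤-pred-≡suc : ∀ {m n k} → m ≡ suc n → m ≤ suc k → n ≤ k
≤-pred-≡suc refl = ≤-pred

matchLoop-fuel : ∀ {k k′} ts → opens ts ≤ k → opens ts ≤ k′ → matchLoop k ts ≡ matchLoop k′ ts
matchLoop-fuel {zero}  {zero}   ts _ _ = refl
matchLoop-fuel {zero}  {suc k′} ts h _ = sym (matchLoop-exhausted k′ ts h)
matchLoop-fuel {suc k} {zero}   ts _ h = matchLoop-exhausted k ts h
matchLoop-fuel {suc k} {suc k′} ts h h′ with findPair ts in eq
... | just (bef , b , aft) = cong (b ∷_) (matchLoop-fuel (bef ++ aft) (fewer h) (fewer h′))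
  where
  fewer : ∀ {m} → opens ts ≤ suc m → opens (bef ++ aft) ≤ m
  fewer = ≤-pred-≡suc (findPair-opens ts eq)
... | nothing with wrapPair ts in eq′
...   | just (b , mid) = cong (b ∷_) (matchLoop-fuel mid (fewer h) (fewer h′))
  where
  fewer : ∀ {m} → opens ts ≤ suc m → opens mid ≤ m
  fewer = ≤-pred-≡suc (wrapPair-opens ts eq′)
...   | nothing = refl

leftover-covers : ∀ ts {x} → x ∈ₗ elems ts → Any (x ∈ₗ_) (leftover ts)
leftover-covers ts p with elems ts
... | _ ∷ _ = here p

matchLoop-covers : ∀ k ts {x} → x ∈ₗ elems ts → Any (x ∈ₗ_) (matchLoop k ts)
matchLoop-covers zero ts p = leftover-covers ts p
matchLoop-covers (suc k) ts p with findPair ts in eq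
... | just (bef , b , aft) with ∈-++⁻ b (findPair-elems ts eq p)
...   | inj₁ q = here q
...   | inj₂ q = there (matchLoop-covers k (bef ++ aft) q)
matchLoop-covers (suc k) ts p | nothing with wrapPair ts in eq′
... | just (b , mid) with ∈-++⁻ b (wrapPair-elems ts eq′ p)
...   | inj₁ q = here q
...   | inj₂ q = there (matchLoop-covers k mid q)
matchLoop-covers (suc k) ts p | nothing | nothing = leftover-covers ts p

data ElemInsertion : List Tok → List Tok → Set where
  []     : ElemInsertion [] []
  keep   : ∀ {xs ys} t → ElemInsertion xs ys → ElemInsertion (t ∷ xs) (t ∷ ys)
  insert : ∀ {xs ys} x → ElemInsertion xs ys → ElemInsertion xs (el x ∷ ys)

ElemInsertion-refl : ∀ xs → ElemInsertion xs xs
ElemInsertion-refl []       = []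
ElemInsertion-refl (t ∷ xs) = keep t (ElemInsertion-refl xs)

ElemInsertion-++ : ∀ {as bs cs ds} → ElemInsertion as bs → ElemInsertion cs ds →
                   ElemInsertion (as ++ cs) (bs ++ ds)
ElemInsertion-++ []           f = f
ElemInsertion-++ (keep t e)   f = keep t (ElemInsertion-++ e f)
ElemInsertion-++ (insert x e) f = insert x (ElemInsertion-++ e f)

ElemInsertion-reverse : ∀ {xs ys} → ElemInsertion xs ys → ElemInsertion (reverse xs) (reverse ys)
ElemInsertion-reverse [] = []
ElemInsertion-reverse {t ∷ xs} {t ∷ ys} (keep t e)
  rewrite unfold-reverse t xs | unfold-reverse t ys =
  ElemInsertion-++ (ElemInsertion-reverse e) (keep t [])
ElemInsertion-reverse {xs} {el x ∷ ys} (insert x e)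
  rewrite unfold-reverse (el x) ys | sym (++-identityʳ (reverse xs)) =
  ElemInsertion-++ (ElemInsertion-reverse e) (insert x [])

BlockGrowth : List ℤ × List Tok → List ℤ × List Tok → Set
BlockGrowth (b , rest) (b′ , rest′) = b ⊆ b′ × ElemInsertion rest rest′

PairGrowth : List Tok × List ℤ × List Tok → List Tok × List ℤ × List Tok → Set
PairGrowth (bef , b , aft) (bef′ , b′ , aft′) = BlockGrowth (b , bef ++ aft) (b′ , bef′ ++ aft′)

elemsThenRp-insertion : ∀ {xs ys} → ElemInsertion xs ys →
                        Pointwise BlockGrowth (elemsThenRp xs) (elemsThenRp ys)
elemsThenRp-insertion [] = nothing
elemsThenRp-insertion (keep lp e) = nothing
elemsThenRp-insertion (keep rp e) = just ((λ ()) , e)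
elemsThenRp-insertion {el y ∷ xs} {el y ∷ ys} (keep (el y) e)
  with elemsThenRp xs | elemsThenRp ys | elemsThenRp-insertion e
... | just _ | just _ | just (s , f) = just (∷⁺ʳ y s , f)
... | nothing | nothing | nothing = nothing
elemsThenRp-insertion {xs} {el x ∷ ys} (insert x e)
  with elemsThenRp xs | elemsThenRp ys | elemsThenRp-insertion e
... | just _ | just (b′ , _) | just (s , f) = just (⊆-trans s (xs⊆x∷xs b′ x) , f)
... | nothing | nothing | nothing = nothing

findPair-insertion : ∀ {xs ys} → ElemInsertion xs ys →
                     Pointwise PairGrowth (findPair xs) (findPair ys)
findPair-insertion [] = nothing
findPair-insertion {lp ∷ xs} {lp ∷ ys} (keep lp e)
  with elemsThenRp xs | elemsThenRp ys | elemsThenRp-insertion e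
... | just _ | just _ | just g = just g
... | nothing | nothing | nothing
  with findPair xs | findPair ys | findPair-insertion e
...   | just _ | just _ | just (s , f) = just (s , keep lp f)
...   | nothing | nothing | nothing = nothing
findPair-insertion {rp ∷ xs} {rp ∷ ys} (keep rp e)
  with findPair xs | findPair ys | findPair-insertion e
... | just _ | just _ | just (s , f) = just (s , keep rp f)
... | nothing | nothing | nothing = nothing
findPair-insertion {el y ∷ xs} {el y ∷ ys} (keep (el y) e)
  with findPair xs | findPair ys | findPair-insertion e
... | just _ | just _ | just (s , f) = just (s , keep (el y) f)
... | nothing | nothing | nothing = nothing
findPair-insertion {xs} {el x ∷ ys} (insert x e)
  with findPair xs | findPair ys | findPair-insertion e
... | just _ | just _ | just (s , f) = just (s , insert x f)
... | nothing | nothing | nothing = nothing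

ParenAligned : List Tok → List Tok → Set
ParenAligned []       []        = ⊤
ParenAligned (lp ∷ r) (lp ∷ r′) = ElemInsertion r r′
ParenAligned (rp ∷ r) (rp ∷ r′) = ElemInsertion r r′
ParenAligned _        _         = ⊥

leadElems-insertion : ∀ {xs ys} → ElemInsertion xs ys →
                      let (a , r) = leadElems xs ; (a′ , r′) = leadElems ys in a ⊆ a′ × ParenAligned r r′
leadElems-insertion [] = ⊆-refl , tt
leadElems-insertion (keep lp e) = ⊆-refl , e
leadElems-insertion (keep rp e) = ⊆-refl , e
leadElems-insertion {el y ∷ xs} {el y ∷ ys} (keep (el y) e)
  with leadElems xs | leadElems ys | leadElems-insertion e
... | _ | _ | s , h = ∷⁺ʳ y s , h
leadElems-insertion {xs} {el x ∷ ys} (insert x e)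
  with leadElems xs | leadElems ys | leadElems-insertion e
... | _ | (a′ , _) | s , h = ⊆-trans s (xs⊆x∷xs a′ x) , h

wrapPair-insertion : ∀ {xs ys} → ElemInsertion xs ys →
                     Pointwise BlockGrowth (wrapPair xs) (wrapPair ys)
wrapPair-insertion {xs} {ys} e with leadElems xs | leadElems ys | leadElems-insertion e
... | (_ , [])     | (_ , [])      | _ = nothing
... | (_ , lp ∷ _) | (_ , lp ∷ _)  | _ = nothing
... | (_ , rp ∷ r) | (_ , rp ∷ r′) | s , f
  with leadElems (reverse r) | leadElems (reverse r′) | leadElems-insertion (ElemInsertion-reverse f)
...   | (_ , [])     | (_ , [])     | _ = nothing
...   | (_ , rp ∷ _) | (_ , rp ∷ _) | _ = nothing
...   | (_ , lp ∷ _) | (_ , lp ∷ _) | s′ , f′ = just (++⁺ (⊆-reverse s′) s , ElemInsertion-reverse f′)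

elems-insertion : ∀ {xs ys} → ElemInsertion xs ys → elems xs ⊆ elems ys
elems-insertion []              = ⊆-refl
elems-insertion (keep lp e)     = elems-insertion e
elems-insertion (keep rp e)     = elems-insertion e
elems-insertion (keep (el y) e) = ∷⁺ʳ y (elems-insertion e)
elems-insertion (insert x e)    = λ p → there (elems-insertion e p)

leftover-insertion : ∀ {xs ys} → ElemInsertion xs ys → leftover xs ≤NC leftover ys
leftover-insertion {xs} {ys} e with elems xs | elems ys | elems-insertion e
... | []    | _      | _ = []
... | _ ∷ _ | []     | s with s (here refl)
...   | ()
leftover-insertion e | _ ∷ _ | _ ∷ _ | s = here s ∷ []

matchLoop-insertion : ∀ k {xs ys} → ElemInsertion xs ys → matchLoop k xs ≤NC matchLoop k ys
matchLoop-insertion zero e = leftover-insertion e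
matchLoop-insertion (suc k) {xs} {ys} e with findPair xs | findPair ys | findPair-insertion e
... | just _ | just (_ , b′ , _) | just (s , f) = here s ∷ ≤NC-there b′ (matchLoop-insertion k f)
... | nothing | nothing | nothing with wrapPair xs | wrapPair ys | wrapPair-insertion e
...   | just _ | just (b′ , _) | just (s , f) = here s ∷ ≤NC-there b′ (matchLoop-insertion k f)
...   | nothing | nothing | nothing = leftover-insertion e

elemsThenRp-++ : ∀ A D {b r} → elemsThenRp A ≡ just (b , r) → elemsThenRp (A ++ D) ≡ just (b , r ++ D)
elemsThenRp-++ (rp ∷ A) D refl = refl
elemsThenRp-++ (el y ∷ A) D eq with elemsThenRp A in eq′
elemsThenRp-++ (el y ∷ A) D refl | just _ rewrite elemsThenRp-++ A D eq′ = refl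

elemsThenRp-++-lp : ∀ A D → elemsThenRp A ≡ nothing → elemsThenRp (A ++ lp ∷ D) ≡ nothing
elemsThenRp-++-lp []        D _ = refl
elemsThenRp-++-lp (lp ∷ A)  D _ = refl
elemsThenRp-++-lp (el y ∷ A) D eq with elemsThenRp A in eq′
elemsThenRp-++-lp (el y ∷ A) D refl | nothing rewrite elemsThenRp-++-lp A D eq′ = refl

elemsThenRp-blocked-++ : ∀ A D {p} → elemsThenRp A ≡ nothing → findPair A ≡ just p →
                         elemsThenRp (A ++ D) ≡ nothing
elemsThenRp-blocked-++ (lp ∷ A) D _ _ = refl
elemsThenRp-blocked-++ (el y ∷ A) D eq eq′ with elemsThenRp A in e | findPair A in f
elemsThenRp-blocked-++ (el y ∷ A) D refl refl | nothing | just _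
  rewrite elemsThenRp-blocked-++ A D e f = refl

findPair-++ : ∀ A D {bef b aft} → findPair A ≡ just (bef , b , aft) →
              findPair (A ++ D) ≡ just (bef , b , aft ++ D)
findPair-++ (lp ∷ A) D eq with elemsThenRp A in e
findPair-++ (lp ∷ A) D refl | just _ rewrite elemsThenRp-++ A D e = refl
... | nothing with findPair A in f
findPair-++ (lp ∷ A) D refl | nothing | just _
  rewrite elemsThenRp-blocked-++ A D e f | findPair-++ A D f = refl
findPair-++ (rp ∷ A) D eq with findPair A in f
findPair-++ (rp ∷ A) D refl | just _ rewrite findPair-++ A D f = refl
findPair-++ (el y ∷ A) D eq with findPair A in f
findPair-++ (el y ∷ A) D refl | just _ rewrite findPair-++ A D f = refl

parenthesised : ℤ → List Tok
parenthesised x = lp ∷ el x ∷ rp ∷ []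

findPair-parenthesised : ∀ A x C → findPair A ≡ nothing →
                         findPair (A ++ parenthesised x ++ C) ≡ just (A , x ∷ [] , C)
findPair-parenthesised [] x C _ = refl
findPair-parenthesised (lp ∷ A) x C eq with elemsThenRp A in e
... | nothing with findPair A in f
findPair-parenthesised (lp ∷ A) x C refl | nothing | nothing
  rewrite elemsThenRp-++-lp A (el x ∷ rp ∷ C) e | findPair-parenthesised A x C f = refl
findPair-parenthesised (rp ∷ A) x C eq with findPair A in f
findPair-parenthesised (rp ∷ A) x C refl | nothing rewrite findPair-parenthesised A x C f = refl
findPair-parenthesised (el y ∷ A) x C eq with findPair A in f
findPair-parenthesised (el y ∷ A) x C refl | nothing rewrite findPair-parenthesised A x C f = refl

matchLoop-parenthesised : ∀ {k} A x C → opens (A ++ C) ≤ k →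
  matchLoop (suc k) (A ++ parenthesised x ++ C) ≤NC (matchLoop k (A ++ C) ∷ʳ (x ∷ []))
matchLoop-parenthesised {k} A x C h with findPair A in eq
... | nothing rewrite findPair-parenthesised A x C eq =
  Any.++⁺ʳ _ (here ⊆-refl) ∷ All-map Any.++⁺ˡ (≤NC-refl _)
... | just (bef , b , aft) with k
...   | zero with () ← subst (_≤ 0) (findPair-opens (A ++ C) (findPair-++ A C eq)) h
...   | suc k′ rewrite findPair-++ A (parenthesised x ++ C) eq | findPair-++ A C eq =
  here ⊆-refl ∷ ≤NC-there b removed
  where
  fewerOpens : opens ((bef ++ aft) ++ C) ≤ k′
  fewerOpens = subst (_≤ k′) (cong opens (sym (++-assoc bef aft C)))
                 (≤-pred-≡suc (findPair-opens (A ++ C) (findPair-++ A C eq)) h)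
  removed : matchLoop (suc k′) (bef ++ aft ++ parenthesised x ++ C)
            ≤NC (matchLoop k′ (bef ++ aft ++ C) ∷ʳ (x ∷ []))
  removed = subst₂ (λ u v → matchLoop (suc k′) u ≤NC (matchLoop k′ v ∷ʳ (x ∷ [])))
              (++-assoc bef aft _) (++-assoc bef aft C) (matchLoop-parenthesised (bef ++ aft) x C fewerOpens)

blocks : List Tok → Partition
blocks ts = matchLoop (length ts) ts

blocks-unparenthesise : ∀ A x C → blocks (A ++ parenthesised x ++ C) ≤NC blocks (A ++ el x ∷ C)
blocks-unparenthesise A x C =
  subst₂ _≤NC_ (sym fuelBefore) fuelAfter
    (≤NC-trans (matchLoop-parenthesised A x C (opens≤length (A ++ C)))
               (≤NC-∷ʳ-covered (matchLoop-insertion k inserted) (matchLoop-covers k (A ++ el x ∷ C) x∈)))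
  where
  k : ℕ
  k = length (A ++ C)
  opensAfter : opens (A ++ el x ∷ C) ≡ opens (A ++ C)
  opensAfter = trans (opens-++ A (el x ∷ C)) (sym (opens-++ A C))
  fuelBefore : blocks (A ++ parenthesised x ++ C) ≡ matchLoop (suc k) (A ++ parenthesised x ++ C)
  fuelBefore = matchLoop-fuel (A ++ parenthesised x ++ C) (opens≤length (A ++ parenthesised x ++ C))
                 (subst (_≤ suc k) (sym (opens-pair A (x ∷ []) C)) (s≤s (opens≤length (A ++ C))))
  fuelAfter : matchLoop k (A ++ el x ∷ C) ≡ blocks (A ++ el x ∷ C)
  fuelAfter = matchLoop-fuel (A ++ el x ∷ C) (subst (_≤ k) (sym opensAfter) (opens≤length (A ++ C)))
                (opens≤length (A ++ el x ∷ C))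
  inserted : ElemInsertion (A ++ C) (A ++ el x ∷ C)
  inserted = ElemInsertion-++ (ElemInsertion-refl A) (insert x (ElemInsertion-refl C))
  x∈ : x ∈ₗ elems (A ++ el x ∷ C)
  x∈ rewrite elems-++ A (el x ∷ C) = ∈-++⁺ʳ (elems A) (here refl)

lookup-─-⁅⁆-self : ∀ {n} (p : Subset n) i → lookup (p ─ ⁅ i ⁆) i ≡ false
lookup-─-⁅⁆-self (x ∷ p) zero    = refl
lookup-─-⁅⁆-self (x ∷ p) (suc i) = lookup-─-⁅⁆-self p i

lookup-─-⁅⁆-other : ∀ {n} (p : Subset n) {i j} → j ≢ i → lookup (p ─ ⁅ i ⁆) j ≡ lookup p j
lookup-─-⁅⁆-other (x ∷ p) {zero}  {zero}  j≢i = ⊥-elim (j≢i refl)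
lookup-─-⁅⁆-other (x ∷ p) {zero}  {suc j} j≢i = cong (λ q → lookup q j) (p─⊥≡p p)
lookup-─-⁅⁆-other (x ∷ p) {suc i} {zero}  j≢i = refl
lookup-─-⁅⁆-other (x ∷ p) {suc i} {suc j} j≢i = lookup-─-⁅⁆-other p (j≢i ∘ cong suc)

elem⁺ elem⁻ : ∀ {n} → Fin n → ℤ
elem⁺ j = + suc (toℕ j)
elem⁻ j = -[1+ toℕ j ]

tokensAt⁺ tokensAt⁻ : ∀ {n} → Subset n → Subset n → Fin n → List Tok
tokensAt⁺ L R j = tokensAt L R j (elem⁺ j)
tokensAt⁻ L R j = tokensAt L R j (elem⁻ j)

module _ {n} (L R : Subset n) (i : Fin n) where

  private
    L′ R′ : Subset n
    L′ = L ─ ⁅ i ⁆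
    R′ = R ─ ⁅ i ⁆

  tokensAt-─-⁅⁆ : ∀ {j} x → j ≢ i → tokensAt L R j x ≡ tokensAt L′ R′ j x
  tokensAt-─-⁅⁆ x j≢i rewrite lookup-─-⁅⁆-other L j≢i | lookup-─-⁅⁆-other R j≢i = refl

  tokensAt-─-⁅⁆-self : ∀ x → tokensAt L′ R′ i x ≡ el x ∷ []
  tokensAt-─-⁅⁆-self x rewrite lookup-─-⁅⁆-self L i | lookup-─-⁅⁆-self R i = refl

  tokensAt-parenthesised : ∀ x → lookup L i ≡ true → lookup R i ≡ true →
                           tokensAt L R i x ≡ parenthesised x
  tokensAt-parenthesised x i∈L i∈R rewrite i∈L | i∈R = refl

  tokens-unparenthesise : lookup L i ≡ true → lookup R i ≡ true →
    ∃[ A ] ∃[ M ] ∃[ C ] tokens L R ≡ A ++ parenthesised (elem⁺ i) ++ M ++ parenthesised (elem⁻ i) ++ C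
                       × tokens L′ R′ ≡ A ++ el (elem⁺ i) ∷ M ++ el (elem⁻ i) ∷ C
  tokens-unparenthesise i∈L i∈R
    with concat-tabulate-split (tokensAt⁺ L R) (tokensAt⁺ L′ R′) i (λ j → tokensAt-─-⁅⁆ _)
       | concat-tabulate-split (tokensAt⁻ L R) (tokensAt⁻ L′ R′) i (λ j → tokensAt-─-⁅⁆ _)
  ... | A , M₁ , p , p′ | M₂ , C , q , q′ = A , M₁ ++ M₂ , C , before , after
    where
    before : tokens L R ≡ A ++ parenthesised (elem⁺ i) ++ (M₁ ++ M₂) ++ parenthesised (elem⁻ i) ++ C
    before = begin
      tokens L R
        ≡⟨ cong₂ _++_ (concatMap-allFin (tokensAt⁺ L R)) (concatMap-allFin (tokensAt⁻ L R)) ⟩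
      concat (tabulate (tokensAt⁺ L R)) ++ concat (tabulate (tokensAt⁻ L R))
        ≡⟨ cong₂ _++_ p q ⟩
      (A ++ tokensAt⁺ L R i ++ M₁) ++ (M₂ ++ tokensAt⁻ L R i ++ C)
        ≡⟨ ++-regroup A _ M₁ M₂ _ C ⟩
      A ++ tokensAt⁺ L R i ++ (M₁ ++ M₂) ++ tokensAt⁻ L R i ++ C
        ≡⟨ cong₂ (λ u v → A ++ u ++ (M₁ ++ M₂) ++ v ++ C)
                 (tokensAt-parenthesised _ i∈L i∈R) (tokensAt-parenthesised _ i∈L i∈R) ⟩
      A ++ parenthesised _ ++ (M₁ ++ M₂) ++ parenthesised _ ++ C ∎
      where open ≡-Reasoning
    after : tokens L′ R′ ≡ A ++ el (elem⁺ i) ∷ (M₁ ++ M₂) ++ el (elem⁻ i) ∷ C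
    after = begin
      tokens L′ R′
        ≡⟨ cong₂ _++_ (concatMap-allFin (tokensAt⁺ L′ R′)) (concatMap-allFin (tokensAt⁻ L′ R′)) ⟩
      concat (tabulate (tokensAt⁺ L′ R′)) ++ concat (tabulate (tokensAt⁻ L′ R′))
        ≡⟨ cong₂ _++_ p′ q′ ⟩
      (A ++ tokensAt⁺ L′ R′ i ++ M₁) ++ (M₂ ++ tokensAt⁻ L′ R′ i ++ C)
        ≡⟨ ++-regroup A _ M₁ M₂ _ C ⟩
      A ++ tokensAt⁺ L′ R′ i ++ (M₁ ++ M₂) ++ tokensAt⁻ L′ R′ i ++ C
        ≡⟨ cong₂ (λ u v → A ++ u ++ (M₁ ++ M₂) ++ v ++ C)
                 (tokensAt-─-⁅⁆-self _) (tokensAt-─-⁅⁆-self _) ⟩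
      A ++ el _ ∷ (M₁ ++ M₂) ++ el _ ∷ C ∎
      where open ≡-Reasoning

lemma3p4 : (n : ℕ) (L R : Subset n) → ∣ L ∣ ≡ ∣ R ∣ → (i : Fin n) → i ∈ L → i ∈ R →
    η L R ≤NC η (L ─ ⁅ i ⁆) (R ─ ⁅ i ⁆)
-- The balance ∣ L ∣ ≡ ∣ R ∣ only ensures that η L R lies in NC_B(n); the refinement holds without it.
lemma3p4 n L R _ i i∈L i∈R with tokens-unparenthesise L R i ([]=⇒lookup i∈L) ([]=⇒lookup i∈R)
... | A , M , C , before , after =
  subst₂ (λ ts ts′ → blocks ts ≤NC blocks ts′) (sym before) (sym after)
    (≤NC-trans (blocks-unparenthesise A x (M ++ parenthesised x̄ ++ C)) unparenthesise-x̄)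
  where
  x x̄ : ℤ
  x = elem⁺ i
  x̄ = elem⁻ i
  unparenthesise-x̄ : blocks (A ++ el x ∷ M ++ parenthesised x̄ ++ C)
                     ≤NC blocks (A ++ el x ∷ M ++ el x̄ ∷ C)
  unparenthesise-x̄ = subst₂ (λ ts ts′ → blocks ts ≤NC blocks ts′)
    (++-assoc A (el x ∷ M) _) (++-assoc A (el x ∷ M) _)
    (blocks-unparenthesise (A ++ el x ∷ M) x̄ C)
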